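{- Let $i\in[1..n]$ and $\ell\in[0..n)$, and set $W=\langle \mathsf{T}_{\tau[i]}\rangle[1..\ell]$ and $\hat W=\langle \mathsf{T}_{\tau[i]-1}\rangle[1..\ell+1]$. Then: (1) if $\mathsf{L}[i]\in\Sigma_s$, then $\hat W=\mathsf{L}[i]\,W$; (2) if $\mathsf{L}[i]$ is an integer and $\mathsf{L}[i]>\mathrm{zeros}(W)$, then $\hat W=0\,W$; (3) if $\mathsf{L}[i]$ is an integer with $\mathsf{L}[i]\le \mathrm{zeros}(W)$, and $d$ is the position of the $\mathsf{L}[i]$-th occurrence of $0$ in $W$, then $\hat W=0\cdot W[1..d-1]\cdot d\cdot W[d+1..\ell]$.
   Context: Let $\Sigma_s$ (static symbols) and $\Sigma_p$ (parameter symbols) be disjoint finite ordered alphabets. $\Sigma_s$ is disjoint from the integers, and every s-symbol is smaller than every integer. A p-string is a string over $\Sigma_s\cup\Sigma_p$. The prev-encoding $\langle w\rangle$ of a p-string $w$ of length $m$ is the string of length $m$ with $\langle w\rangle[i]=w[i]$ if $w[i]\in\Sigma_s$; $\langle w\rangle[i]=0$ if $w[i]\in\Sigma_p$ does not occur in $w[1..i-1]$; and $\langle w\rangle[i]=i-j$ otherwise, where $j$ is the largest position in $[1..i-1]$ with $w[j]=w[i]$. Write $\mathrm{zeros}(X)$ for the number of occurrences of $0$ in $X$. Strings are compared lexicographically, with a proper prefix smaller than any extension. Here $X[a..b]$ denotes the empty string if $b<a$. $\mathsf{T}$ is a p-string of length $n$ with $\mathsf{T}[n]=\$$, where $\$$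 is the smallest s-symbol and does not occur elsewhere in $\mathsf{T}$. For an integer $i$, $\mathsf{T}_i=\mathsf{T}[i'..n]\mathsf{T}[1..i'-1]$, where $i'\in[1..n]$ and $i'\equiv i \pmod n$. Let $\tau$ be the permutation of $[1..n]$ such that $\langle \mathsf{T}_{\tau[i]}\rangle$ is the $i$-th lexicographically smallest string among $\{\langle \mathsf{T}_{i'}\rangle\}_{i'=1}^n$. The pBWT of $\mathsf{T}$ is the string $\mathsf{L}$ of length $n$ defined by: - $\mathsf{L}[i]=\mathsf{T}_{\tau[i]}[n]$ if $\mathsf{T}_{\tau[i]}[n]\in\Sigma_s$; - otherwise $\mathsf{L}[i]=\mathrm{zeros}(\langle \mathsf{T}_{\tau[i]}[1..j]\rangle)$, where $j$ is the smallest position with $\mathsf{T}_{\tau[i]}[j]=\mathsf{T}_{\tau[i]}[n]$. -}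

module Defs where

open import Data.Nat using (ℕ; zero; suc; _+_; _∸_; _<_; _≤_)
open import Data.Nat.DivMod using (_mod_)
open import Data.Bool using (Bool; true; false; if_then_else_)
open import Data.Fin as Fin using (Fin; toℕ)
open import Data.List using (List; []; _∷_; _++_; [_]; map; upTo; take; drop; length)
open import Data.Maybe using (Maybe; just; nothing; maybe)
open import Data.Product using (Σ; _×_; _,_)
open import Relation.Binary.PropositionalEquality using (_≡_)
open import Relation.Nullary using (yes; no)

-- Symbols: Σ_s = Fin σ (static symbols, ordered as Fin),
--          Σ_p = Fin π (parameter symbols). Disjoint by construction.
data Sym (σ π : ℕ) : Set where
  static : Fin σ → Sym σ π
  param  : Fin π → Sym σ π

sameSym : ∀ {σ π} → Sym σ π → Sym σ π → Bool
sameSym (static a) (static b) with a Fin.≟ b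
... | yes _ = true
... | no _  = false
sameSym (param a) (param b) with a Fin.≟ b
... | yes _ = true
... | no _  = false
sameSym _ _ = false

data Enc (σ : ℕ) : Set where
  s   : Fin σ → Enc σ
  num : ℕ → Enc σ

data _<E_ {σ : ℕ} : Enc σ → Enc σ → Set where
  s<s     : ∀ {a b} → a Fin.< b → s a <E s b
  s<num   : ∀ {a k} → s a <E num k
  num<num : ∀ {j k} → j < k → num j <E num k

data _<Lex_ {σ : ℕ} : List (Enc σ) → List (Enc σ) → Set where
  []<∷  : ∀ {y ys} → [] <Lex (y ∷ ys)
  head< : ∀ {x y xs ys} → x <E y → (x ∷ xs) <Lex (y ∷ ys)
  tail< : ∀ {x xs ys} → xs <Lex ys → (x ∷ xs) <Lex (x ∷ ys)

-- lastDist u a : for u = w[1..i-1], the distance i - j where j is the largest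
-- position of u with u[j] = a (nothing if a does not occur in u).
lastDist : ∀ {σ π} → List (Sym σ π) → Sym σ π → Maybe ℕ
lastDist [] a = nothing
lastDist (x ∷ u) a with lastDist u a
... | just d  = just d
... | nothing = if sameSym x a then just (suc (length u)) else nothing

encAt : ∀ {σ π} → List (Sym σ π) → Sym σ π → Enc σ
encAt u (static c) = s c
encAt u (param p)  = maybe num (num 0) (lastDist u (param p))

encode′ : ∀ {σ π} → List (Sym σ π) → List (Sym σ π) → List (Enc σ)
encode′ u []       = []
encode′ u (x ∷ xs) = encAt u x ∷ encode′ (u ++ [ x ]) xs

⟨_⟩ : ∀ {σ π} → List (Sym σ π) → List (Enc σ)
⟨ w ⟩ = encode′ [] w

zeros : ∀ {σ} → List (Enc σ) → ℕ
zeros []             = 0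
zeros (num zero ∷ X) = suc (zeros X)
zeros (_ ∷ X)        = zeros X

-- 1-based position of the first occurrence of a in w (length w + 1 if absent)
firstPos : ∀ {σ π} → Sym σ π → List (Sym σ π) → ℕ
firstPos a []      = 1
firstPos a (x ∷ w) = if sameSym x a then 1 else suc (firstPos a w)

-- Text of length n = suc m, indexed 0-based: T : Fin (suc m) → Sym.
-- Rotation starting at 0-based offset k (paper's T_{k+1}; indices mod n).
rot : ∀ {σ π} m → (Fin (suc m) → Sym σ π) → ℕ → List (Sym σ π)
rot m T k = map (λ j → T ((k + j) mod (suc m))) (upTo (suc m))

-- Well-formed text: last letter is $ (= smallest s-symbol, Fin zero), and $
-- occurs nowhere else.
WellFormedText : ∀ {σ π} m → (Fin (suc m) → Sym (suc σ) π) → Set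
WellFormedText m T =
  (T (Fin.fromℕ m) ≡ static Fin.zero) ×
  (∀ k → T k ≡ static Fin.zero → k ≡ Fin.fromℕ m)

-- τ sorts the rotations: ⟨T_{τ[i]}⟩ is the i-th smallest (rotations are
-- pairwise distinct, so this is strict monotonicity).
IsSortingPerm : ∀ {σ π} m → (Fin (suc m) → Sym σ π) →
                (Fin (suc m) → Fin (suc m)) → Set
IsSortingPerm m T τ =
  ∀ i j → i Fin.< j → ⟨ rot m T (toℕ (τ i)) ⟩ <Lex ⟨ rot m T (toℕ (τ j)) ⟩

pbwtLetter : ∀ {σ π} → List (Sym σ π) → Sym σ π → Enc σ
pbwtLetter w (static c) = s c
pbwtLetter w (param p)  = num (zeros ⟨ take (firstPos (param p) w) w ⟩)

L : ∀ {σ π} m → (Fin (suc m) → Sym σ π) → (Fin (suc m) → Fin (suc m)) →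
    Fin (suc m) → Enc σ
L m T τ i = pbwtLetter (rot m T (toℕ (τ i)))
                       (T ((toℕ (τ i) + m) mod (suc m)))

-- d is the (1-based) position of the k-th occurrence of 0 in W
KthZeroAt : ∀ {σ} → ℕ → List (Enc σ) → ℕ → Set
KthZeroAt {σ} k W d =
  (1 ≤ d) × (Σ (List (Enc σ)) λ rest → drop (d ∸ 1) W ≡ num 0 ∷ rest) ×
  (zeros (take d W) ≡ k)

{-# OPTIONS --safe #-}
-- Write w = T_{τ[i]} = v·c, so that T_{τ[i]-1} = c·v: only the cyclic structure of the
-- rotations is used, not the sentinel nor the sorting.  Prepending c to a prefix of w
-- changes its prev-encoding in at most one place, namely the first occurrence of c in w.
-- If c is static nothing changes.  If c is a parameter first occurring at position j of
-- w, the new leading c encodes as 0 and position j, which encoded as 0 and was therefore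
-- the (1 + zeros ⟨w[1..j-1]⟩)-th = L[i]-th zero of ⟨w⟩, now encodes as j; when ℓ < j
-- the window W contains fewer than L[i] zeros and is unchanged.
module Submission where

open import Defs
open import Data.Nat using (ℕ; suc; _+_; _∸_; _<_; _≤_)
open import Data.Fin using (Fin; toℕ)
open import Data.List using (List; _∷_; _++_; take; drop)
open import Relation.Binary.PropositionalEquality using (_≡_)
open import Data.Product using (_×_)

open import Data.Bool using (true; false)
open import Data.Empty using (⊥-elim)
open import Data.Fin as Fin using ()
open import Data.Fin.Properties using (fromℕ<-cong)
open import Data.List using ([]; [_]; map; upTo; applyUpTo; length)
open import Data.List.Properties
  using (++-assoc; ++-identityʳ; take++drop≡id; map-++; map-∘; map-cong; map-upTo; upTo-∷ʳ; length-map; length-upTo)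
open import Data.List.Relation.Unary.All using (All; []; _∷_)
open import Data.List.Relation.Unary.All.Properties using (take⁺)
open import Data.Maybe using (just; nothing; maybe)
open import Data.Nat using (zero; s≤s; z≤n)
open import Data.Nat.DivMod using (_mod_; [m+n]%n≡m%n)
open import Data.Nat.Properties using (+-comm; +-suc; +-identityʳ; m≤m+n; suc-injective; <⇒≱; module ≤-Reasoning)
open import Data.Nat.Tactic.RingSolver using (solve-∀)
open import Data.Product using (∃; ∃₂; _,_; proj₂)
open import Data.Sum using (_⊎_; inj₁; inj₂)
open import Relation.Binary.PropositionalEquality using (refl; sym; trans; cong; cong₂; subst; subst₂; module ≡-Reasoning)
open import Relation.Nullary using (yes; no)

take-++ˡ : ∀ {a} {A : Set a} (ℓ : ℕ) (xs ys : List A) → ℓ ≤ length xs →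
           take ℓ (xs ++ ys) ≡ take ℓ xs
take-++ˡ zero    xs       ys _         = refl
take-++ˡ (suc ℓ) (x ∷ xs) ys (s≤s ℓ≤) = cong (x ∷_) (take-++ˡ ℓ xs ys ℓ≤)

take-++-∷ : ∀ {a} {A : Set a} (ℓ : ℕ) (xs : List A) (y : A) (ys : List A) →
            take ℓ (xs ++ y ∷ ys) ≡ take ℓ xs ⊎ ∃ λ j → take ℓ (xs ++ y ∷ ys) ≡ xs ++ y ∷ take j ys
take-++-∷ zero    xs       y ys = inj₁ refl
take-++-∷ (suc ℓ) []       y ys = inj₂ (ℓ , refl)
take-++-∷ (suc ℓ) (x ∷ xs) y ys with take-++-∷ ℓ xs y ys
... | inj₁ eq       = inj₁ (cong (x ∷_) eq)
... | inj₂ (j , eq) = inj₂ (j , cong (x ∷_) eq)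

take-length-++ : ∀ {a} {A : Set a} (xs ys : List A) → take (length xs) (xs ++ ys) ≡ xs
take-length-++ []       ys = refl
take-length-++ (x ∷ xs) ys = cong (x ∷_) (take-length-++ xs ys)

take-suc-length-++-∷ : ∀ {a} {A : Set a} (xs : List A) (y : A) (ys : List A) →
                       take (suc (length xs)) (xs ++ y ∷ ys) ≡ xs ++ [ y ]
take-suc-length-++-∷ []       y ys = refl
take-suc-length-++-∷ (x ∷ xs) y ys = cong (x ∷_) (take-suc-length-++-∷ xs y ys)

drop-length-++-∷ : ∀ {a} {A : Set a} (xs : List A) (y : A) (ys : List A) →
                   drop (suc (length xs)) (xs ++ y ∷ ys) ≡ ys
drop-length-++-∷ []       y ys = refl
drop-length-++-∷ (x ∷ xs) y ys = drop-length-++-∷ xs y ys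

module _ {σ : ℕ} where

  zeros-++ : (X Y : List (Enc σ)) → zeros (X ++ Y) ≡ zeros X + zeros Y
  zeros-++ []                 Y = refl
  zeros-++ (num zero    ∷ X) Y = cong suc (zeros-++ X Y)
  zeros-++ (num (suc _) ∷ X) Y = zeros-++ X Y
  zeros-++ (s _         ∷ X) Y = zeros-++ X Y

  zeros-take-suc-at-zero : (j : ℕ) (X : List (Enc σ)) {rest : List (Enc σ)} →
                           drop j X ≡ num 0 ∷ rest →
                           zeros (take (suc j) X) ≡ suc (zeros (take j X))
  zeros-take-suc-at-zero zero    (x ∷ X) refl = refl
  zeros-take-suc-at-zero (suc j) (num zero    ∷ X) eq = cong suc (zeros-take-suc-at-zero j X eq)
  zeros-take-suc-at-zero (suc j) (num (suc _) ∷ X) eq = zeros-take-suc-at-zero j X eq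
  zeros-take-suc-at-zero (suc j) (s _         ∷ X) eq = zeros-take-suc-at-zero j X eq

  kthZeroAt-++-∷ : (A B : List (Enc σ)) (d : ℕ) →
                   KthZeroAt (suc (zeros A)) (A ++ num 0 ∷ B) d → d ≡ suc (length A)
  kthZeroAt-++-∷ [] B (suc zero) _ = refl
  kthZeroAt-++-∷ [] B (suc (suc j)) (_ , (_ , at) , count)
    with () ← trans (sym (zeros-take-suc-at-zero j B at)) (suc-injective count)
  kthZeroAt-++-∷ (num zero ∷ A) B (suc zero) (_ , _ , ())
  kthZeroAt-++-∷ (num zero ∷ A) B (suc (suc j)) (_ , at , count) =
    cong suc (kthZeroAt-++-∷ A B (suc j) (s≤s z≤n , at , suc-injective count))
  kthZeroAt-++-∷ (num (suc _) ∷ A) B (suc (suc j)) (_ , at , count) =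
    cong suc (kthZeroAt-++-∷ A B (suc j) (s≤s z≤n , at , count))
  kthZeroAt-++-∷ (s _ ∷ A) B (suc (suc j)) (_ , at , count) =
    cong suc (kthZeroAt-++-∷ A B (suc j) (s≤s z≤n , at , count))

  LeftExtension : Enc σ → List (Enc σ) → List (Enc σ) → Set
  LeftExtension Lᵢ W Ŵ =
      (∀ c → Lᵢ ≡ s c → Ŵ ≡ s c ∷ W)
    × (∀ k → Lᵢ ≡ num k → zeros W < k → Ŵ ≡ num 0 ∷ W)
    × (∀ k → Lᵢ ≡ num k → k ≤ zeros W → ∀ d → KthZeroAt k W d →
         Ŵ ≡ num 0 ∷ (take (d ∸ 1) W ++ (num d ∷ drop d W)))

  leftExtension-static : (c : Fin σ) (W : List (Enc σ)) → LeftExtension (s c) W (s c ∷ W)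
  leftExtension-static c W = (λ { _ refl → refl }) , (λ _ ()) , (λ _ ())

  leftExtension-fresh : (k : ℕ) (W : List (Enc σ)) → zeros W < k →
                        LeftExtension (num k) W (num 0 ∷ W)
  leftExtension-fresh k W W<k =
    (λ _ ()) , (λ { _ refl _ → refl }) , (λ { _ refl k≤W → ⊥-elim (<⇒≱ W<k k≤W) })

  leftExtension-kthZero : (A B : List (Enc σ)) →
                          LeftExtension (num (suc (zeros A))) (A ++ num 0 ∷ B)
                                        (num 0 ∷ (A ++ num (suc (length A)) ∷ B))
  leftExtension-kthZero A B =
      (λ _ ())
    , (λ { _ refl W<k → ⊥-elim (<⇒≱ W<k enough-zeros) })
    , (λ { _ refl _ d kth → Ŵ≡ d (kthZeroAt-++-∷ A B d kth) })
    where
    enough-zeros : suc (zeros A) ≤ zeros (A ++ num 0 ∷ B)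
    enough-zeros = begin
      suc (zeros A)               ≤⟨ s≤s (m≤m+n (zeros A) (zeros B)) ⟩
      suc (zeros A + zeros B)     ≡⟨ sym (+-suc (zeros A) (zeros B)) ⟩
      zeros A + zeros (num 0 ∷ B) ≡⟨ sym (zeros-++ A (num 0 ∷ B)) ⟩
      zeros (A ++ num 0 ∷ B)      ∎
      where open ≤-Reasoning
    Ŵ≡ : (d : ℕ) → d ≡ suc (length A) →
         num 0 ∷ (A ++ num (suc (length A)) ∷ B) ≡
         num 0 ∷ (take (d ∸ 1) (A ++ num 0 ∷ B) ++ (num d ∷ drop d (A ++ num 0 ∷ B)))
    Ŵ≡ _ refl = cong (num 0 ∷_) (cong₂ (λ X Y → X ++ num (suc (length A)) ∷ Y)
                   (sym (take-length-++ A (num 0 ∷ B))) (sym (drop-length-++-∷ A (num 0) B)))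

module _ {σ π : ℕ} where

  sameSym-refl : (a : Sym σ π) → sameSym a a ≡ true
  sameSym-refl (static a) with a Fin.≟ a
  ... | yes _ = refl
  ... | no a≢a = ⊥-elim (a≢a refl)
  sameSym-refl (param a) with a Fin.≟ a
  ... | yes _ = refl
  ... | no a≢a = ⊥-elim (a≢a refl)

  sameSym-true⇒≡ : (a b : Sym σ π) → sameSym a b ≡ true → a ≡ b
  sameSym-true⇒≡ (static a) (static b) _ with a Fin.≟ b
  sameSym-true⇒≡ (static a) (static b) _  | yes refl = refl
  sameSym-true⇒≡ (static a) (static b) () | no _
  sameSym-true⇒≡ (param a)  (param b)  _ with a Fin.≟ b
  sameSym-true⇒≡ (param a)  (param b)  _  | yes refl = refl
  sameSym-true⇒≡ (param a)  (param b)  () | no _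

  sameSym-false-sym : (a b : Sym σ π) → sameSym a b ≡ false → sameSym b a ≡ false
  sameSym-false-sym a b a≠b with sameSym b a in b=a
  ... | false = refl
  ... | true with sameSym-true⇒≡ b a b=a
  ...   | refl = trans (sym (sameSym-refl a)) a≠b

  Absent : Sym σ π → List (Sym σ π) → Set
  Absent c = All (λ x → sameSym x c ≡ false)

  lastDist-absent : (a : Sym σ π) (q : List (Sym σ π)) → Absent a q → lastDist q a ≡ nothing
  lastDist-absent a []      []         = refl
  lastDist-absent a (y ∷ q) (y≠a ∷ ≠a) rewrite lastDist-absent a q ≠a | y≠a = refl

  lastDist-∷-other : (c : Sym σ π) (q : List (Sym σ π)) (a : Sym σ π) → sameSym c a ≡ false →
                     lastDist (c ∷ q) a ≡ lastDist q a
  lastDist-∷-other c q a c≠a with lastDist q a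
  ... | just _  = refl
  ... | nothing rewrite c≠a = refl

  lastDist-∷-just : (c : Sym σ π) (q : List (Sym σ π)) (a : Sym σ π) {d : ℕ} →
                    lastDist q a ≡ just d → lastDist (c ∷ q) a ≡ just d
  lastDist-∷-just c q a eq with lastDist q a | eq
  ... | just _ | refl = refl

  lastDist-∷ʳ-just : (q : List (Sym σ π)) (x a : Sym σ π) {d : ℕ} → lastDist q a ≡ just d →
                     ∃ λ d′ → lastDist (q ++ [ x ]) a ≡ just d′
  lastDist-∷ʳ-just (y ∷ q) x a eq with lastDist (q ++ [ x ]) a in eq′
  ... | just d′ = d′ , refl
  ... | nothing with lastDist q a in eq″
  ...   | just _ with () ← trans (sym eq′) (proj₂ (lastDist-∷ʳ-just q x a eq″))
  ...   | nothing with sameSym y a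
  ...     | true = _ , refl
  lastDist-∷ʳ-just (y ∷ q) x a () | nothing | nothing | false

  lastDist-∷ʳ-self : (q : List (Sym σ π)) (a : Sym σ π) → lastDist (q ++ [ a ]) a ≡ just 1
  lastDist-∷ʳ-self []      a rewrite sameSym-refl a = refl
  lastDist-∷ʳ-self (y ∷ q) a rewrite lastDist-∷ʳ-self q a = refl

  encAt-∷-other : (c : Sym σ π) (q : List (Sym σ π)) (x : Sym σ π) → sameSym c x ≡ false →
                  encAt (c ∷ q) x ≡ encAt q x
  encAt-∷-other c q (static x) _   = refl
  encAt-∷-other c q (param x)  c≠x = cong (maybe num (num 0)) (lastDist-∷-other c q (param x) c≠x)

  encAt-∷-seen : (c : Sym σ π) (q : List (Sym σ π)) (x : Sym σ π) {d : ℕ} →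
                 lastDist q x ≡ just d → encAt (c ∷ q) x ≡ encAt q x
  encAt-∷-seen c q (static x) _  = refl
  encAt-∷-seen c q (param x)  eq =
    cong (maybe num (num 0)) (trans (lastDist-∷-just c q (param x) eq) (sym eq))

  encode′-∷-static : (c : Fin σ) (q xs : List (Sym σ π)) →
                     encode′ (static c ∷ q) xs ≡ encode′ q xs
  encode′-∷-static c q []       = refl
  encode′-∷-static c q (x ∷ xs) =
    cong₂ _∷_ (encAt-static x) (encode′-∷-static c (q ++ [ x ]) xs)
    where
    encAt-static : (x : Sym σ π) → encAt (static c ∷ q) x ≡ encAt q x
    encAt-static (static _) = refl
    encAt-static (param p)  = encAt-∷-other (static c) q (param p) refl

  encode′-∷-absent : (c : Sym σ π) (q xs : List (Sym σ π)) → Absent c xs →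
                     encode′ (c ∷ q) xs ≡ encode′ q xs
  encode′-∷-absent c q []       []           = refl
  encode′-∷-absent c q (x ∷ xs) (x≠c ∷ ≠c) =
    cong₂ _∷_ (encAt-∷-other c q x (sameSym-false-sym x c x≠c)) (encode′-∷-absent c (q ++ [ x ]) xs ≠c)

  encode′-∷-seen : (c : Sym σ π) (q xs : List (Sym σ π)) {d : ℕ} → lastDist q c ≡ just d →
                   encode′ (c ∷ q) xs ≡ encode′ q xs
  encode′-∷-seen c q []       _  = refl
  encode′-∷-seen c q (x ∷ xs) eq =
    cong₂ _∷_ head (encode′-∷-seen c (q ++ [ x ]) xs (proj₂ (lastDist-∷ʳ-just q x c eq)))
    where
    head : encAt (c ∷ q) x ≡ encAt q x
    head with sameSym c x in c=x
    ... | false = encAt-∷-other c q x c=x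
    ... | true with sameSym-true⇒≡ c x c=x
    ...   | refl = encAt-∷-seen c q c eq

  encode′-++ : (p xs ys : List (Sym σ π)) →
               encode′ p (xs ++ ys) ≡ encode′ p xs ++ encode′ (p ++ xs) ys
  encode′-++ p []       ys rewrite ++-identityʳ p = refl
  encode′-++ p (x ∷ xs) ys rewrite encode′-++ (p ++ [ x ]) xs ys | ++-assoc p [ x ] xs = refl

  take-encode′ : (ℓ : ℕ) (p xs : List (Sym σ π)) → take ℓ (encode′ p xs) ≡ encode′ p (take ℓ xs)
  take-encode′ zero    p xs       = refl
  take-encode′ (suc ℓ) p []       = refl
  take-encode′ (suc ℓ) p (x ∷ xs) = cong (encAt p x ∷_) (take-encode′ ℓ (p ++ [ x ]) xs)

  length-encode′ : (p xs : List (Sym σ π)) → length (encode′ p xs) ≡ length xs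
  length-encode′ p []       = refl
  length-encode′ p (x ∷ xs) = cong suc (length-encode′ (p ++ [ x ]) xs)

  zeros-⟨take⟩-≤ : (ℓ : ℕ) (u : List (Sym σ π)) → zeros ⟨ take ℓ u ⟩ ≤ zeros ⟨ u ⟩
  zeros-⟨take⟩-≤ ℓ u = begin
    zeros ⟨ take ℓ u ⟩
      ≤⟨ m≤m+n _ _ ⟩
    zeros ⟨ take ℓ u ⟩ + zeros (encode′ (take ℓ u) (drop ℓ u))
      ≡⟨ sym (zeros-++ ⟨ take ℓ u ⟩ _) ⟩
    zeros (⟨ take ℓ u ⟩ ++ encode′ (take ℓ u) (drop ℓ u))
      ≡⟨ cong zeros (sym (encode′-++ [] (take ℓ u) (drop ℓ u))) ⟩
    zeros ⟨ take ℓ u ++ drop ℓ u ⟩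
      ≡⟨ cong (λ v → zeros ⟨ v ⟩) (take++drop≡id ℓ u) ⟩
    zeros ⟨ u ⟩ ∎
    where open ≤-Reasoning

  firstOccurrence : (v : List (Sym σ π)) (c : Sym σ π) →
                    ∃₂ λ w₁ w₂ → v ++ [ c ] ≡ w₁ ++ c ∷ w₂ × Absent c w₁
  firstOccurrence []      c = [] , [] , refl , []
  firstOccurrence (x ∷ v) c with sameSym x c in x=c
  ... | true with sameSym-true⇒≡ x c x=c
  ...   | refl = [] , v ++ [ c ] , refl , []
  firstOccurrence (x ∷ v) c | false with firstOccurrence v c
  ...   | w₁ , w₂ , eq , ≠c = x ∷ w₁ , w₂ , cong (x ∷_) eq , x=c ∷ ≠c

  firstPos-++-∷ : (c : Sym σ π) (w₁ w₂ : List (Sym σ π)) → Absent c w₁ →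
                  firstPos c (w₁ ++ c ∷ w₂) ≡ suc (length w₁)
  firstPos-++-∷ c []       w₂ []         rewrite sameSym-refl c = refl
  firstPos-++-∷ c (y ∷ w₁) w₂ (y≠c ∷ ≠c) rewrite y≠c = cong suc (firstPos-++-∷ c w₁ w₂ ≠c)

  module _ (p : Fin π) (w₁ : List (Sym σ π)) (p∉w₁ : Absent (param p) w₁) where

    ⟨++-∷⟩ : (u : List (Sym σ π)) →
             ⟨ w₁ ++ param p ∷ u ⟩ ≡ ⟨ w₁ ⟩ ++ num 0 ∷ encode′ (w₁ ++ [ param p ]) u
    ⟨++-∷⟩ u = trans (encode′-++ [] w₁ (param p ∷ u))
                     (cong (λ e → ⟨ w₁ ⟩ ++ maybe num (num 0) e ∷ encode′ (w₁ ++ [ param p ]) u)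
                           (lastDist-absent (param p) w₁ p∉w₁))

    ⟨∷-++-∷⟩ : (u : List (Sym σ π)) →
               ⟨ param p ∷ w₁ ++ param p ∷ u ⟩ ≡
               num 0 ∷ (⟨ w₁ ⟩ ++ num (suc (length w₁)) ∷ encode′ (w₁ ++ [ param p ]) u)
    ⟨∷-++-∷⟩ u = cong (num 0 ∷_) (begin
      encode′ [ c ] (w₁ ++ c ∷ u)
        ≡⟨ encode′-++ [ c ] w₁ (c ∷ u) ⟩
      encode′ [ c ] w₁ ++ encAt (c ∷ w₁) c ∷ encode′ (c ∷ w₁ ++ [ c ]) u
        ≡⟨ cong₂ (λ X e → X ++ e ∷ encode′ (c ∷ w₁ ++ [ c ]) u)
                 (encode′-∷-absent c [] w₁ p∉w₁) encAt-first-occurrence ⟩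
      ⟨ w₁ ⟩ ++ num (suc (length w₁)) ∷ encode′ (c ∷ w₁ ++ [ c ]) u
        ≡⟨ cong (λ B → ⟨ w₁ ⟩ ++ num (suc (length w₁)) ∷ B)
                (encode′-∷-seen c (w₁ ++ [ c ]) u (lastDist-∷ʳ-self w₁ c)) ⟩
      ⟨ w₁ ⟩ ++ num (suc (length w₁)) ∷ encode′ (w₁ ++ [ c ]) u ∎)
      where
      open ≡-Reasoning
      c = param p
      encAt-first-occurrence : encAt (c ∷ w₁) c ≡ num (suc (length w₁))
      encAt-first-occurrence rewrite lastDist-absent c w₁ p∉w₁ | sameSym-refl c = refl

    pbwtLetter-++-∷ : (w₂ : List (Sym σ π)) →
                      pbwtLetter (w₁ ++ param p ∷ w₂) (param p) ≡ num (suc (zeros ⟨ w₁ ⟩))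
    pbwtLetter-++-∷ w₂ = cong num (begin
      zeros ⟨ take (firstPos c w) w ⟩
        ≡⟨ cong (λ j → zeros ⟨ take j w ⟩) (firstPos-++-∷ c w₁ w₂ p∉w₁) ⟩
      zeros ⟨ take (suc (length w₁)) w ⟩
        ≡⟨ cong (λ v → zeros ⟨ v ⟩) (take-suc-length-++-∷ w₁ c w₂) ⟩
      zeros ⟨ w₁ ++ [ c ] ⟩
        ≡⟨ cong zeros (⟨++-∷⟩ []) ⟩
      zeros (⟨ w₁ ⟩ ++ [ num 0 ])
        ≡⟨ zeros-++ ⟨ w₁ ⟩ [ num 0 ] ⟩
      zeros ⟨ w₁ ⟩ + 1
        ≡⟨ +-comm (zeros ⟨ w₁ ⟩) 1 ⟩
      suc (zeros ⟨ w₁ ⟩) ∎)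
      where
      open ≡-Reasoning
      c = param p
      w = w₁ ++ c ∷ w₂

    leftExtension-param : (w₂ : List (Sym σ π)) (ℓ : ℕ) →
                          let w = w₁ ++ param p ∷ w₂ in
                          LeftExtension (pbwtLetter w (param p)) ⟨ take ℓ w ⟩ ⟨ param p ∷ take ℓ w ⟩
    leftExtension-param w₂ ℓ =
      subst (λ Lᵢ → LeftExtension Lᵢ ⟨ take ℓ w ⟩ ⟨ c ∷ take ℓ w ⟩)
            (sym (pbwtLetter-++-∷ w₂)) by-window
      where
      c = param p
      w = w₁ ++ c ∷ w₂
      K = suc (zeros ⟨ w₁ ⟩)
      by-window : LeftExtension (num K) ⟨ take ℓ w ⟩ ⟨ c ∷ take ℓ w ⟩
      by-window with take-++-∷ ℓ w₁ c w₂
      ... | inj₁ eq = subst (λ t → LeftExtension (num K) ⟨ t ⟩ ⟨ c ∷ t ⟩) (sym eq)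
            (subst (LeftExtension (num K) ⟨ take ℓ w₁ ⟩)
                   (cong (num 0 ∷_) (sym (encode′-∷-absent c [] (take ℓ w₁) (take⁺ ℓ p∉w₁))))
                   (leftExtension-fresh K ⟨ take ℓ w₁ ⟩ (s≤s (zeros-⟨take⟩-≤ ℓ w₁))))
      ... | inj₂ (j , eq) = subst (λ t → LeftExtension (num K) ⟨ t ⟩ ⟨ c ∷ t ⟩) (sym eq)
            (subst₂ (LeftExtension (num K)) (sym (⟨++-∷⟩ u)) (sym (⟨∷-++-∷⟩ u))
              (subst (λ n → LeftExtension (num K) (⟨ w₁ ⟩ ++ num 0 ∷ B)
                                           (num 0 ∷ (⟨ w₁ ⟩ ++ num (suc n) ∷ B)))
                     (length-encode′ [] w₁) (leftExtension-kthZero ⟨ w₁ ⟩ B)))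
        where
        u = take j w₂
        B = encode′ (w₁ ++ [ c ]) u

  leftExtension-∷ʳ : (v : List (Sym σ π)) (c : Sym σ π) (ℓ : ℕ) →
                     let w = v ++ [ c ] in
                     LeftExtension (pbwtLetter w c) ⟨ take ℓ w ⟩ ⟨ c ∷ take ℓ w ⟩
  leftExtension-∷ʳ v (static c) ℓ =
    subst (LeftExtension (s c) ⟨ take ℓ (v ++ [ static c ]) ⟩)
          (cong (s c ∷_) (sym (encode′-∷-static c [] (take ℓ (v ++ [ static c ])))))
          (leftExtension-static c _)
  leftExtension-∷ʳ v (param p) ℓ with firstOccurrence v (param p)
  ... | w₁ , w₂ , eq , p∉w₁ =
    subst (λ w → LeftExtension (pbwtLetter w (param p)) ⟨ take ℓ w ⟩ ⟨ param p ∷ take ℓ w ⟩)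
          (sym eq) (leftExtension-param p w₁ p∉w₁ w₂ ℓ)

module _ {σ π : ℕ} (m : ℕ) (T : Fin (suc m) → Sym σ π) where

  letterAt : ℕ → ℕ → Sym σ π
  letterAt k j = T ((k + j) mod suc m)

  rotInit : ℕ → List (Sym σ π)
  rotInit k = map (letterAt k) (upTo m)

  rot≡rotInit-∷ʳ : (k : ℕ) → rot m T k ≡ rotInit k ++ [ letterAt k m ]
  rot≡rotInit-∷ʳ k =
    trans (cong (map (letterAt k)) (sym (upTo-∷ʳ m))) (map-++ (letterAt k) (upTo m) [ m ])

  letterAt-+-suc : (k j : ℕ) → letterAt (k + m) (suc j) ≡ letterAt k j
  letterAt-+-suc k j =
    cong T (trans (cong (_mod suc m) (shift k m j)) (fromℕ<-cong _ _ ([m+n]%n≡m%n (k + j) (suc m)) _ _))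
    where
    shift : ∀ k m j → k + m + suc j ≡ k + j + suc m
    shift = solve-∀

  -- n = m + 1, so rotating by m more brings the last letter of T_k to the front.
  rot-+≡∷rotInit : (k : ℕ) → rot m T (k + m) ≡ letterAt k m ∷ rotInit k
  rot-+≡∷rotInit k = cong₂ _∷_ (cong (λ x → T (x mod suc m)) (+-identityʳ (k + m))) (begin
    map (letterAt (k + m)) (applyUpTo suc m)      ≡⟨ cong (map (letterAt (k + m))) (sym (map-upTo suc m)) ⟩
    map (letterAt (k + m)) (map suc (upTo m))     ≡⟨ sym (map-∘ (upTo m)) ⟩
    map (λ j → letterAt (k + m) (suc j)) (upTo m) ≡⟨ map-cong (letterAt-+-suc k) (upTo m) ⟩
    rotInit k                                     ∎)
    where open ≡-Reasoning

  take-suc-rot-+ : (k ℓ : ℕ) → ℓ ≤ m →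
                   take (suc ℓ) (rot m T (k + m)) ≡ letterAt k m ∷ take ℓ (rot m T k)
  take-suc-rot-+ k ℓ ℓ≤m = begin
    take (suc ℓ) (rot m T (k + m))
      ≡⟨ cong (take (suc ℓ)) (rot-+≡∷rotInit k) ⟩
    letterAt k m ∷ take ℓ (rotInit k)
      ≡⟨ cong (letterAt k m ∷_) (sym (take-++ˡ ℓ (rotInit k) _ ℓ≤∣rotInit∣)) ⟩
    letterAt k m ∷ take ℓ (rotInit k ++ [ letterAt k m ])
      ≡⟨ cong (λ w → letterAt k m ∷ take ℓ w) (sym (rot≡rotInit-∷ʳ k)) ⟩
    letterAt k m ∷ take ℓ (rot m T k) ∎
    where
    open ≡-Reasoning
    ℓ≤∣rotInit∣ : ℓ ≤ length (rotInit k)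
    ℓ≤∣rotInit∣ = subst (ℓ ≤_) (sym (trans (length-map (letterAt k) (upTo m)) (length-upTo m))) ℓ≤m

proposition1 : ∀ {σ π : ℕ} (m : ℕ) (T : Fin (suc m) → Sym (suc σ) π)
    (τ : Fin (suc m) → Fin (suc m)) →
    WellFormedText m T → IsSortingPerm m T τ →
    ∀ (i : Fin (suc m)) (ℓ : ℕ) → ℓ < suc m →
    let W  = take ℓ ⟨ rot m T (toℕ (τ i)) ⟩
        W^ = take (suc ℓ) ⟨ rot m T (toℕ (τ i) + m) ⟩
    in (∀ c → L m T τ i ≡ s c → W^ ≡ s c ∷ W)
     × (∀ k → L m T τ i ≡ num k → zeros W < k → W^ ≡ num 0 ∷ W)
     × (∀ k → L m T τ i ≡ num k → k ≤ zeros W → ∀ d → KthZeroAt k W d →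
          W^ ≡ num 0 ∷ (take (d ∸ 1) W ++ (num d ∷ drop d W)))
proposition1 m T τ _ _ i ℓ (s≤s ℓ≤m) =
  subst₂ (LeftExtension (L m T τ i)) (sym W≡) (sym Ŵ≡) extension
  where
  k = toℕ (τ i)
  w = rot m T k
  c = letterAt m T k m
  extension : LeftExtension (pbwtLetter w c) ⟨ take ℓ w ⟩ ⟨ c ∷ take ℓ w ⟩
  extension = subst (λ w → LeftExtension (pbwtLetter w c) ⟨ take ℓ w ⟩ ⟨ c ∷ take ℓ w ⟩)
                    (sym (rot≡rotInit-∷ʳ m T k)) (leftExtension-∷ʳ (rotInit m T k) c ℓ)
  W≡ : take ℓ ⟨ w ⟩ ≡ ⟨ take ℓ w ⟩
  W≡ = take-encode′ ℓ [] w
  Ŵ≡ : take (suc ℓ) ⟨ rot m T (k + m) ⟩ ≡ ⟨ c ∷ take ℓ w ⟩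
  Ŵ≡ = trans (take-encode′ (suc ℓ) [] (rot m T (k + m))) (cong ⟨_⟩ (take-suc-rot-+ m T k ℓ ℓ≤m))
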